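{- Let $P_5$ be the set $\mathbb{N}\times\mathbb{N}\times\mathbb{N}$ (with $\mathbb{N}=\{0,1,2,\dots\}$) ordered by setting $(x,y,n)\leq(u,v,m)$ if and only if at least one of the following holds: (i) $n\geq m+2$; (ii) $n=m$, $x\leq u$ and $y\leq v$; (iii) $n=m+1$ and $\min\{x,y\}+1\leq\min\{u,v\}$; (iv) $n=m+1$ and $x+y\leq 2(u+v)$. Then $P_5$ contains no infinite antichain. -}

module Defs where

open import Data.Nat using (ℕ; suc; _+_; _*_; _≤_; _⊔_; _⊓_)
open import Data.Product using (_×_; _,_)
open import Data.Sum using (_⊎_)
open import Relation.Binary.PropositionalEquality using (_≡_)
open import Relation.Nullary using (¬_)

P₅ : Set
P₅ = ℕ × ℕ × ℕ

data _≤P₅_ : P₅ → P₅ → Set where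
  case-i   : ∀ {x y n u v m} → suc (suc m) ≤ n → (x , y , n) ≤P₅ (u , v , m)
  case-ii  : ∀ {x y n u v m} → n ≡ m → x ≤ u → y ≤ v → (x , y , n) ≤P₅ (u , v , m)
  case-iii : ∀ {x y n u v m} → n ≡ suc m → suc (x ⊓ y) ≤ u ⊓ v → (x , y , n) ≤P₅ (u , v , m)
  case-iv  : ∀ {x y n u v m} → n ≡ suc m → x + y ≤ 2 * (u + v) → (x , y , n) ≤P₅ (u , v , m)

-- An infinite antichain, presented as a sequence whose terms at distinct
-- indices are incomparable (this forces the terms to be distinct).
IsInfiniteAntichain : (ℕ → P₅) → Set
IsInfiniteAntichain f = ∀ i j → ¬ (i ≡ j) → ¬ (f i ≤P₅ f j)

{-# OPTIONS --safe #-}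
-- Two terms of an antichain have levels at most one apart, by (i). Hence, up to a double
-- negation (harmless, as the goal is ⊥), an infinite antichain lives on the levels of two of
-- its terms f p and f q. On a single level (ii) contains the product order of ℕ², and relative
-- to an anchor (a , b) every other term has x < a or y < b; numbering it by that coordinate
-- injects the level into {0, …, a + b}. Stacking the codes of the two levels injects ℕ into a
-- finite set, contradicting the pigeonhole principle.
module Submission where

open import Defs
open import Data.Nat using (ℕ; suc; _+_; _≤_; _<_; z<s; s≤s; s≤s⁻¹; _≟_; _<?_)
open import Data.Nat.Properties
open import Data.Fin using (Fin; toℕ; fromℕ<)
open import Data.Fin.Properties using (injective⇒≤; toℕ-injective; toℕ-fromℕ<)
open import Data.Product using (Σ; _×_; _,_; proj₁; proj₂)
open import Data.Sum as Sum using (_⊎_; inj₁; inj₂)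
open import Data.Empty using (⊥-elim)
open import Function using (_∘_)
open import Function.Definitions using (Injective)
open import Relation.Nullary using (¬_; yes; no)
open import Relation.Nullary.Decidable using (decidable-stable)
open import Relation.Binary.PropositionalEquality using (_≡_; _≢_; refl; sym; trans; cong; subst)

no-injective-bounded-code : ∀ {N} (R : ℕ → ℕ → Set) → (∀ k → Σ ℕ λ c → c < N × R k c) →
                            ¬ (∀ {i j c} → R i c → R j c → i ≡ j)
no-injective-bounded-code {N} R code unique = 1+n≰n (injective⇒≤ code-injective)
  where
  codeᶠ : Fin (suc N) → Fin N
  codeᶠ k = fromℕ< (proj₁ (proj₂ (code (toℕ k))))

  code-injective : Injective _≡_ _≡_ codeᶠ
  code-injective {i} {j} eq = toℕ-injective (unique (proj₂ (proj₂ (code (toℕ i)))) Rⱼ)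
    where
    same-code : proj₁ (code (toℕ j)) ≡ proj₁ (code (toℕ i))
    same-code = trans (sym (toℕ-fromℕ< _)) (trans (cong toℕ (sym eq)) (toℕ-fromℕ< _))

    Rⱼ : R (toℕ j) (proj₁ (code (toℕ i)))
    Rⱼ = subst (R (toℕ j)) same-code (proj₂ (proj₂ (code (toℕ j))))

m≤n≤1+m⇒n≡m∨n≡1+m : ∀ {m n} → m ≤ n → n ≤ suc m → n ≡ m ⊎ n ≡ suc m
m≤n≤1+m⇒n≡m∨n≡1+m m≤n n≤1+m = Sum.map₁ (λ n<1+m → ≤-antisym (s≤s⁻¹ n<1+m) m≤n) (m≤n⇒m<n∨m≡n n≤1+m)

distinct-within-1⇒adjacent : ∀ {m n} → m ≤ suc n → n ≤ suc m → m ≢ n → n ≡ suc m ⊎ m ≡ suc n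
distinct-within-1⇒adjacent {m} {n} m≤1+n n≤1+m m≢n with ≤-total m n
... | inj₁ m≤n = inj₁ (≤-antisym n≤1+m (≤∧≢⇒< m≤n m≢n))
... | inj₂ n≤m = inj₂ (≤-antisym m≤1+n (≤∧≢⇒< n≤m (m≢n ∘ sym)))

Spread≤1 : (ℕ → ℕ) → Set
Spread≤1 ℓ = ∀ i j → ℓ i ≤ suc (ℓ j)

ValuesAmong : (ℕ → ℕ) → ℕ → ℕ → Set
ValuesAmong ℓ p q = ∀ k → ℓ k ≡ ℓ p ⊎ ℓ k ≡ ℓ q

module _ {ℓ : ℕ → ℕ} (spread : Spread≤1 ℓ) where

  spread≤1-adjacent-values : ∀ {p q} → ℓ q ≡ suc (ℓ p) → ValuesAmong ℓ p q
  spread≤1-adjacent-values {p} {q} ℓq≡1+ℓp k =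
    Sum.map₂ (λ ℓk≡1+ℓp → trans ℓk≡1+ℓp (sym ℓq≡1+ℓp))
      (m≤n≤1+m⇒n≡m∨n≡1+m (s≤s⁻¹ (subst (_≤ suc (ℓ k)) ℓq≡1+ℓp (spread q k))) (spread k p))

  spread≤1-distinct-values : ∀ {p q} → ℓ p ≢ ℓ q → ValuesAmong ℓ p q
  spread≤1-distinct-values {p} {q} ℓp≢ℓq with distinct-within-1⇒adjacent (spread p q) (spread q p) ℓp≢ℓq
  ... | inj₁ ℓq≡1+ℓp = spread≤1-adjacent-values ℓq≡1+ℓp
  ... | inj₂ ℓp≡1+ℓq = Sum.swap ∘ spread≤1-adjacent-values ℓp≡1+ℓq

  spread≤1⇒¬¬two-valued : ¬ ¬ (Σ ℕ λ p → Σ ℕ λ q → ValuesAmong ℓ p q)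
  spread≤1⇒¬¬two-valued no-pair = no-pair (0 , 0 , inj₁ ∘ constant)
    where
    constant : ∀ k → ℓ k ≡ ℓ 0
    constant k = decidable-stable (ℓ k ≟ ℓ 0)
                   (λ ℓk≢ℓ0 → no-pair (0 , k , spread≤1-distinct-values (ℓk≢ℓ0 ∘ sym)))

_≤²_ : ℕ × ℕ → ℕ × ℕ → Set
(x , y) ≤² (u , v) = x ≤ u × y ≤ v

Comparable² : ℕ × ℕ → ℕ × ℕ → Set
Comparable² P Q = P ≤² Q ⊎ Q ≤² P

x≡u⇒comparable² : ∀ {x y u v} → x ≡ u → Comparable² (x , y) (u , v)
x≡u⇒comparable² {y = y} {v = v} refl = Sum.map (≤-refl ,_) (≤-refl ,_) (≤-total y v)

y≡v⇒comparable² : ∀ {x y u v} → y ≡ v → Comparable² (x , y) (u , v)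
y≡v⇒comparable² {x} {u = u} refl = Sum.map (_, ≤-refl) (_, ≤-refl) (≤-total x u)

codeBound : ℕ × ℕ → ℕ
codeBound A = suc (proj₁ A + proj₂ A)

data Code (A : ℕ × ℕ) : ℕ × ℕ → ℕ → Set where
  left  : ∀ {x y} → x < proj₁ A → Code A (x , y) (suc x)
  below : ∀ {x y} → y < proj₂ A → Code A (x , y) (suc (proj₁ A + y))
  above : ∀ {P} → A ≤² P → Code A P 0

code : ∀ A P → Σ ℕ (Code A P)
code (a , b) (x , y) with x <? a | y <? b
... | yes x<a | _       = suc x , left x<a
... | no _    | yes y<b = suc (a + y) , below y<b
... | no x≮a  | no y≮b  = 0 , above (≮⇒≥ x≮a , ≮⇒≥ y≮b)

code-< : ∀ {A P c} → Code A P c → c < codeBound A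
code-< {A} (left x<a)  = s≤s (≤-trans x<a (m≤m+n (proj₁ A) (proj₂ A)))
code-< {A} (below y<b) = s≤s (+-monoʳ-< (proj₁ A) y<b)
code-< (above _)       = z<s

code-collision : ∀ {A P Q c d} → Code A P c → Code A Q d → c ≡ d →
                 Comparable² P Q ⊎ (A ≤² P × A ≤² Q)
code-collision (left _)         (left _)         eq = inj₁ (x≡u⇒comparable² (suc-injective eq))
code-collision {A} (below _)    (below _)        eq =
  inj₁ (y≡v⇒comparable² (+-cancelˡ-≡ (proj₁ A) _ _ (suc-injective eq)))
code-collision (above A≤P)      (above A≤Q)      _  = inj₂ (A≤P , A≤Q)
code-collision {A} (left x<a)   (below _)        eq =
  ⊥-elim (m+n≮m (proj₁ A) _ (subst (_< proj₁ A) (suc-injective eq) x<a))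
code-collision {A} (below _)    (left u<a)       eq =
  ⊥-elim (m+n≮m (proj₁ A) _ (subst (_< proj₁ A) (suc-injective (sym eq)) u<a))
code-collision (left _)         (above _)        ()
code-collision (below _)        (above _)        ()
code-collision (above _)        (left _)         ()
code-collision (above _)        (below _)        ()

plane : P₅ → ℕ × ℕ
plane (x , y , _) = x , y

level : P₅ → ℕ
level (_ , _ , n) = n

same-level-≤² : ∀ {p q} → level p ≡ level q → plane p ≤² plane q → p ≤P₅ q
same-level-≤² {_ , _ , _} {_ , _ , _} eq (x≤u , y≤v) = case-ii eq x≤u y≤v

module _ {f : ℕ → P₅} (anti : IsInfiniteAntichain f) where

  ≤P₅⇒≡ : ∀ {i j} → f i ≤P₅ f j → i ≡ j
  ≤P₅⇒≡ {i} {j} fi≤fj = decidable-stable (i ≟ j) (λ i≢j → anti i j i≢j fi≤fj)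

  level-spread : Spread≤1 (level ∘ f)
  level-spread i j with i ≟ j
  ... | yes refl = n≤1+n (level (f i))
  ... | no i≢j   = s≤s⁻¹ (≰⇒> (anti i j i≢j ∘ case-i))

  comparable⇒≡ : ∀ {i j} → level (f i) ≡ level (f j) → Comparable² (plane (f i)) (plane (f j)) → i ≡ j
  comparable⇒≡ eq (inj₁ i≤j) = ≤P₅⇒≡ (same-level-≤² eq i≤j)
  comparable⇒≡ eq (inj₂ j≤i) = sym (≤P₅⇒≡ (same-level-≤² (sym eq) j≤i))

  LevelCode : ℕ → ℕ → ℕ → Set
  LevelCode p k c = level (f k) ≡ level (f p) × Code (plane (f p)) (plane (f k)) c

  levelCode-injective : ∀ {p i j c d} → LevelCode p i c → LevelCode p j d → c ≡ d → i ≡ j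
  levelCode-injective (ℓi≡ℓp , Cᵢ) (ℓj≡ℓp , Cⱼ) c≡d with code-collision Cᵢ Cⱼ c≡d
  ... | inj₁ comparable = comparable⇒≡ (trans ℓi≡ℓp (sym ℓj≡ℓp)) comparable
  ... | inj₂ (p≤i , p≤j) =
    trans (sym (≤P₅⇒≡ (same-level-≤² (sym ℓi≡ℓp) p≤i))) (≤P₅⇒≡ (same-level-≤² (sym ℓj≡ℓp) p≤j))

  TwoLevelCode : ℕ → ℕ → ℕ → ℕ → Set
  TwoLevelCode p q k c = LevelCode p k c ⊎ Σ ℕ λ d → LevelCode q k d × c ≡ codeBound (plane (f p)) + d

  twoLevelCode : ∀ {p q} → ValuesAmong (level ∘ f) p q → ∀ k →
                 Σ ℕ λ c → c < codeBound (plane (f p)) + codeBound (plane (f q)) × TwoLevelCode p q k c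
  twoLevelCode {p} {q} values k with values k
  ... | inj₁ ℓk≡ℓp = let c , C = code (plane (f p)) (plane (f k)) in
    c , <-≤-trans (code-< C) (m≤m+n _ _) , inj₁ (ℓk≡ℓp , C)
  ... | inj₂ ℓk≡ℓq = let d , D = code (plane (f q)) (plane (f k)) in
    _ , +-monoʳ-< (codeBound (plane (f p))) (code-< D) , inj₂ (d , (ℓk≡ℓq , D) , refl)

  twoLevelCode-injective : ∀ {p q i j c} → TwoLevelCode p q i c → TwoLevelCode p q j c → i ≡ j
  twoLevelCode-injective (inj₁ Cᵢ) (inj₁ Cⱼ) = levelCode-injective Cᵢ Cⱼ refl
  twoLevelCode-injective (inj₂ (_ , Dᵢ , refl)) (inj₂ (_ , Dⱼ , eq)) =
    levelCode-injective Dᵢ Dⱼ (+-cancelˡ-≡ _ _ _ eq)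
  twoLevelCode-injective (inj₁ (_ , Cᵢ)) (inj₂ (_ , _ , refl)) = ⊥-elim (m+n≮m _ _ (code-< Cᵢ))
  twoLevelCode-injective (inj₂ (_ , _ , refl)) (inj₁ (_ , Cⱼ)) = ⊥-elim (m+n≮m _ _ (code-< Cⱼ))

mainTheorem5 : (f : ℕ → P₅) → ¬ IsInfiniteAntichain f
mainTheorem5 f anti = spread≤1⇒¬¬two-valued (level-spread anti) λ (p , q , values) →
  no-injective-bounded-code (TwoLevelCode anti p q) (twoLevelCode anti values) (twoLevelCode-injective anti)
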